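{- Let $M$ be a matroid of rank $k$ on an $n$-element ground set $E$. Then, as rational functions, \[W_{M}(X,Y,Z)=(X-Y)^{n-k}Y^{k}\,t_{M}\!\left(\frac{X}{Y},\frac{X+(Z-1)Y}{X-Y}\right).\]
   Context: For a matroid $M$ on $E$ with rank function $r$, the nullity is $n_M(\sigma)=|\sigma|-r(\sigma)$. The Tutte polynomial is $t_M(X,Y)=\sum_{\sigma\subseteq E}(X-1)^{r(E)-r(\sigma)}(Y-1)^{|\sigma|-r(\sigma)}$. Generalized weight polynomials: $P_{M,0}(Z)=1$ and, for $1\le j\le n$, $P_{M,j}(Z)=(-1)^j\sum_{|\sigma|=j}\sum_{\gamma\subseteq\sigma}(-1)^{|\gamma|}Z^{n_M(\gamma)}$ (sums over subsets of $E$). The enumerator of $M$ is $W_M(X,Y,Z)=\sum_{i=0}^{n}P_{M,i}(Z)X^{n-i}Y^i$. -}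

module Defs where

open import Data.Nat as ℕ using (ℕ; zero; suc; _∸_; _≤_)
open import Data.Bool using (Bool; true; false)
open import Data.List using (List; []; _∷_; map; _++_; filter; foldr)
open import Data.Vec using (Vec; []; _∷_)
open import Data.Fin.Subset using (Subset; _⊆_; _∪_; _∩_; ∣_∣; ⊥; ⊤; inside; outside)
open import Data.Rational using (ℚ; 0ℚ; 1ℚ; _+_; _*_; _-_; -_)
open import Relation.Nullary.Decidable using (does)
open import Relation.Binary.PropositionalEquality using (_≡_)

record Matroid (n : ℕ) : Set where
  field
    rank      : Subset n → ℕ
    rank-≤    : ∀ A → rank A ≤ ∣ A ∣
    rank-mono : ∀ A B → A ⊆ B → rank A ≤ rank B
    rank-sub  : ∀ A B → rank (A ∪ B) ℕ.+ rank (A ∩ B) ≤ rank A ℕ.+ rank B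

open Matroid public

matroidRank : ∀ {n} → Matroid n → ℕ
matroidRank M = rank M ⊤

nullity : ∀ {n} → Matroid n → Subset n → ℕ
nullity M σ = ∣ σ ∣ ∸ rank M σ

allSubsets : (n : ℕ) → List (Subset n)
allSubsets zero    = [] ∷ []
allSubsets (suc n) = map (outside ∷_) (allSubsets n) ++ map (inside ∷_) (allSubsets n)

subsetsOf : ∀ {n} → Subset n → List (Subset n)
subsetsOf []            = [] ∷ []
subsetsOf (false ∷ σ)   = map (outside ∷_) (subsetsOf σ)
subsetsOf (true  ∷ σ)   = map (outside ∷_) (subsetsOf σ) ++ map (inside ∷_) (subsetsOf σ)

subsetsOfSize : (n j : ℕ) → List (Subset n)
subsetsOfSize n j = filter (λ σ → ∣ σ ∣ ℕ.≟ j) (allSubsets n)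

sumℚ : List ℚ → ℚ
sumℚ = foldr _+_ 0ℚ

infixr 8 _^_
_^_ : ℚ → ℕ → ℚ
x ^ zero  = 1ℚ
x ^ suc k = x * (x ^ k)

sgn : ℕ → ℚ
sgn j = (- 1ℚ) ^ j

sumUpTo : ℕ → (ℕ → ℚ) → ℚ
sumUpTo zero    f = f zero
sumUpTo (suc n) f = sumUpTo n f + f (suc n)

tutte : ∀ {n} → Matroid n → ℚ → ℚ → ℚ
tutte {n} M x y =
  sumℚ (map (λ σ → ((x - 1ℚ) ^ (matroidRank M ∸ rank M σ)) * ((y - 1ℚ) ^ nullity M σ))
            (allSubsets n))

weightPoly : ∀ {n} → Matroid n → ℕ → ℚ → ℚ
weightPoly M zero z = 1ℚ
weightPoly {n} M (suc j) z =
  sgn (suc j) *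
  sumℚ (map (λ σ → sumℚ (map (λ γ → sgn ∣ γ ∣ * (z ^ nullity M γ)) (subsetsOf σ)))
            (subsetsOfSize n (suc j)))

enumerator : ∀ {n} → Matroid n → ℚ → ℚ → ℚ → ℚ
enumerator {n} M x y z = sumUpTo n (λ i → weightPoly M i z * (x ^ (n ∸ i)) * (y ^ i))

module Submission where

-- Write G(γ) = z^{n_M(γ)}.  The enumerator is a sum over
-- sizes i of P_{M,i}(z) x^{n-i} y^i, and each P_{M,i} is itself a sum over
-- the subsets σ of size i (for i = 0 this holds because the only such σ is
-- ∅ and the inner sum is then G(∅) = 1).  Regrouping by size turns W_M into
--   Σ_σ (-1)^|σ| x^{n-|σ|} y^|σ| Σ_{γ⊆σ} (-1)^|γ| G(γ).
-- The exchange formula, proved for an arbitrary G by induction on n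
-- (splitting the subsets of {0..n} according to whether they contain 0),
-- evaluates this double sum as Σ_γ G(γ) y^|γ| (x-y)^{n-|γ|}; this is the
-- binomial theorem for the sum over σ ⊇ γ in disguise.  Finally each term
-- of the right-hand side of the theorem, (x-y)^{n-k} y^k (x/y-1)^{k-r(γ)}
-- ((x+(z-1)y)/(x-y)-1)^{n_M(γ)}, simplifies to G(γ) y^|γ| (x-y)^{n-|γ|}.

open import Defs
open import Data.Nat using (ℕ; _∸_)
open import Data.Rational using (ℚ; 1ℚ; _+_; _*_; _-_; _÷_; NonZero)
open import Relation.Binary.PropositionalEquality using (_≡_)

open import Data.Nat as ℕ using (zero; suc; _≤_; z≤n; s≤s; s≤s⁻¹)
import Data.Nat.Properties as ℕP
open import Data.Rational using (0ℚ; -_; 1/_)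
import Data.Rational.Properties as ℚP
open import Data.Rational.Solver using (module +-*-Solver)
open +-*-Solver
open import Data.List using (List; []; _∷_; map; _++_; filter)
import Data.List.Properties as LP
open import Data.Bool using (Bool; true; false; if_then_else_)
open import Data.Vec using ([]; _∷_)
open import Data.Fin.Subset using (Subset; ∣_∣; ⊥; ⊤; inside; outside)
import Data.Fin.Subset.Properties as SP
open import Relation.Nullary using (Dec; does; ¬_)
open import Relation.Nullary.Decidable using (dec-true; dec-false)
open import Data.Sum using (inj₁; inj₂)
open import Relation.Unary using (Decidable)
open import Relation.Binary.PropositionalEquality
  using (refl; sym; trans; cong; cong₂; subst; module ≡-Reasoning)
open import Function using (_∘_)

∑ : {A : Set} → List A → (A → ℚ) → ℚ
∑ L f = sumℚ (map f L)

module _ {A : Set} where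

  ∑-cong : ∀ {f g : A → ℚ} → (∀ a → f a ≡ g a) → ∀ L → ∑ L f ≡ ∑ L g
  ∑-cong f≗g L = cong sumℚ (LP.map-cong f≗g L)

  ∑-++ : ∀ (f : A → ℚ) xs ys → ∑ (xs ++ ys) f ≡ ∑ xs f + ∑ ys f
  ∑-++ f [] ys = sym (ℚP.+-identityˡ _)
  ∑-++ f (x ∷ xs) ys = trans (cong (f x +_) (∑-++ f xs ys)) (sym (ℚP.+-assoc (f x) _ _))

  ∑-scale : ∀ (c : ℚ) (f : A → ℚ) L → ∑ L (λ a → c * f a) ≡ c * ∑ L f
  ∑-scale c f [] = sym (ℚP.*-zeroʳ c)
  ∑-scale c f (a ∷ L) =
    trans (cong (c * f a +_) (∑-scale c f L)) (sym (ℚP.*-distribˡ-+ c (f a) _))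

  ∑-add : ∀ (f g : A → ℚ) L → ∑ L (λ a → f a + g a) ≡ ∑ L f + ∑ L g
  ∑-add f g [] = refl
  ∑-add f g (a ∷ L) = trans (cong (f a + g a +_) (∑-add f g L))
    (solve 4 (λ p q r s → (p :+ q) :+ (r :+ s) := (p :+ r) :+ (q :+ s)) refl (f a) (g a) _ _)

  ∑-factor : ∀ (c : ℚ) {f g : A → ℚ} → (∀ a → f a ≡ c * g a) → ∀ L → ∑ L f ≡ c * ∑ L g
  ∑-factor c {g = g} f≡cg L = trans (∑-cong f≡cg L) (∑-scale c g L)

∑-map : ∀ {A B : Set} (f : B → ℚ) (g : A → B) L → ∑ (map g L) f ≡ ∑ L (f ∘ g)
∑-map f g L = cong sumℚ (sym (LP.map-∘ L))

∑-images : ∀ {A B : Set} (f : B → ℚ) (g h : A → B) L →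
  ∑ (map g L ++ map h L) f ≡ ∑ L (f ∘ g) + ∑ L (f ∘ h)
∑-images f g h L = trans (∑-++ f (map g L) (map h L)) (cong₂ _+_ (∑-map f g L) (∑-map f h L))

pow-+ : ∀ (p : ℚ) i j → p ^ (i ℕ.+ j) ≡ p ^ i * p ^ j
pow-+ p zero j = sym (ℚP.*-identityˡ _)
pow-+ p (suc i) j = trans (cong (p *_) (pow-+ p i j)) (sym (ℚP.*-assoc p _ _))

pow-* : ∀ (p q : ℚ) d → (p * q) ^ d ≡ p ^ d * q ^ d
pow-* p q zero = refl
pow-* p q (suc d) = trans (cong ((p * q) *_) (pow-* p q d))
  (solve 4 (λ a b c e → (a :* b) :* (c :* e) := (a :* c) :* (b :* e)) refl p q (p ^ d) (q ^ d))

pow-÷-cancel : ∀ (p q iq : ℚ) → q * iq ≡ 1ℚ → ∀ d → (p * iq) ^ d * q ^ d ≡ p ^ d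
pow-÷-cancel p q iq q*iq≡1 zero = refl
pow-÷-cancel p q iq q*iq≡1 (suc d) = begin
    ((p * iq) * U) * (q * Q)
  ≡⟨ solve 5 (λ p q iq U Q → ((p :* iq) :* U) :* (q :* Q) := p :* (q :* iq) :* (U :* Q))
       refl p q iq U Q ⟩
    p * (q * iq) * (U * Q)
  ≡⟨ cong₂ (λ s t → p * s * t) q*iq≡1 (pow-÷-cancel p q iq q*iq≡1 d) ⟩
    p * 1ℚ * p ^ d
  ≡⟨ cong (_* p ^ d) (ℚP.*-identityʳ p) ⟩
    p * p ^ d
  ∎
  where
  open ≡-Reasoning
  U = (p * iq) ^ d
  Q = q ^ d

∸-telescope : ∀ {i j l} → i ≤ j → j ≤ l → (j ∸ i) ℕ.+ (l ∸ j) ≡ l ∸ i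
∸-telescope {i} {j} {l} i≤j j≤l = begin
    (j ∸ i) ℕ.+ (l ∸ j)    ≡⟨ ℕP.+-comm (j ∸ i) (l ∸ j) ⟩
    (l ∸ j) ℕ.+ (j ∸ i)    ≡⟨ sym (ℕP.+-∸-assoc (l ∸ j) i≤j) ⟩
    ((l ∸ j) ℕ.+ j) ∸ i    ≡⟨ cong (_∸ i) (ℕP.m∸n+n≡m j≤l) ⟩
    l ∸ i                  ∎
  where open ≡-Reasoning

pow-telescope : ∀ (p : ℚ) {i j l} → i ≤ j → j ≤ l → p ^ (j ∸ i) * p ^ (l ∸ j) ≡ p ^ (l ∸ i)
pow-telescope p {i} {j} {l} i≤j j≤l =
  trans (sym (pow-+ p (j ∸ i) (l ∸ j))) (cong (p ^_) (∸-telescope i≤j j≤l))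

sumUpTo-cong : ∀ n {f g : ℕ → ℚ} → (∀ i → f i ≡ g i) → sumUpTo n f ≡ sumUpTo n g
sumUpTo-cong zero f≗g = f≗g zero
sumUpTo-cong (suc n) f≗g = cong₂ _+_ (sumUpTo-cong n f≗g) (f≗g (suc n))

sumUpTo-add : ∀ n (f g : ℕ → ℚ) → sumUpTo n (λ i → f i + g i) ≡ sumUpTo n f + sumUpTo n g
sumUpTo-add zero f g = refl
sumUpTo-add (suc n) f g = trans (cong (_+ (f (suc n) + g (suc n))) (sumUpTo-add n f g))
  (solve 4 (λ a b c d → (a :+ b) :+ (c :+ d) := (a :+ c) :+ (b :+ d)) refl
     (sumUpTo n f) (sumUpTo n g) (f (suc n)) (g (suc n)))

sumUpTo-vanish : ∀ n (f : ℕ → ℚ) → (∀ i → i ≤ n → f i ≡ 0ℚ) → sumUpTo n f ≡ 0ℚ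
sumUpTo-vanish zero f f≡0 = f≡0 zero z≤n
sumUpTo-vanish (suc n) f f≡0 =
  cong₂ _+_ (sumUpTo-vanish n f (λ i i≤n → f≡0 i (ℕP.m≤n⇒m≤1+n i≤n))) (f≡0 (suc n) ℕP.≤-refl)

indicator : Bool → ℚ → ℚ
indicator b q = if b then q else 0ℚ

*-indicator : ∀ c b q → c * indicator b q ≡ indicator b (c * q)
*-indicator c true q = refl
*-indicator c false q = ℚP.*-zeroʳ c

indicator-≢ : ∀ {m i} (q : ℚ) → ¬ (m ≡ i) → indicator (does (m ℕ.≟ i)) q ≡ 0ℚ
indicator-≢ {m} {i} q m≢i = cong (λ b → indicator b q) (dec-false (m ℕ.≟ i) m≢i)

sumUpTo-delta : ∀ n {m} (c : ℕ → ℚ) → m ≤ n →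
  sumUpTo n (λ i → indicator (does (m ℕ.≟ i)) (c i)) ≡ c m
sumUpTo-delta zero c z≤n = refl
sumUpTo-delta (suc n) {m} c m≤1+n with ℕP.m≤n⇒m<n∨m≡n m≤1+n
... | inj₁ m<1+n = begin
    sumUpTo n δ + δ (suc n)   ≡⟨ cong₂ _+_ (sumUpTo-delta n c (s≤s⁻¹ m<1+n))
                                           (indicator-≢ (c (suc n)) (ℕP.<⇒≢ m<1+n)) ⟩
    c m + 0ℚ                  ≡⟨ ℚP.+-identityʳ (c m) ⟩
    c m                       ∎
  where
  open ≡-Reasoning
  δ = λ i → indicator (does (m ℕ.≟ i)) (c i)
... | inj₂ refl = begin
    sumUpTo n δ + δ (suc n)   ≡⟨ cong₂ _+_ (sumUpTo-vanish n δ below)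
                                           (cong (λ b → indicator b (c m)) (dec-true (m ℕ.≟ m) refl)) ⟩
    0ℚ + c m                  ≡⟨ ℚP.+-identityˡ (c m) ⟩
    c m                       ∎
  where
  open ≡-Reasoning
  δ = λ i → indicator (does (m ℕ.≟ i)) (c i)
  below : ∀ i → i ≤ n → δ i ≡ 0ℚ
  below i i≤n = indicator-≢ (c i) (ℕP.>⇒≢ (s≤s i≤n))

∑-filter-cons : ∀ {A : Set} {P : A → Set} (P? : Decidable P) (f : A → ℚ) a L →
  ∑ (filter P? (a ∷ L)) f ≡ indicator (does (P? a)) (f a) + ∑ (filter P? L) f
∑-filter-cons P? f a L with does (P? a)
... | true = refl
... | false = sym (ℚP.+-identityˡ _)

sumUpTo-regroup : ∀ {A : Set} (κ : A → ℕ) n (W : ℕ → ℚ) (I : A → ℚ) →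
  (∀ a → κ a ≤ n) → ∀ L →
  sumUpTo n (λ i → W i * ∑ (filter (λ a → κ a ℕ.≟ i) L) I) ≡ ∑ L (λ a → W (κ a) * I a)
sumUpTo-regroup κ n W I κ≤n [] =
  sumUpTo-vanish n (λ i → W i * 0ℚ) (λ i _ → ℚP.*-zeroʳ (W i))
sumUpTo-regroup {A} κ n W I κ≤n (a ∷ L) = begin
    sumUpTo n (λ i → W i * ∑ (layer i (a ∷ L)) I)
  ≡⟨ sumUpTo-cong n split ⟩
    sumUpTo n (λ i → indicator (does (κ a ℕ.≟ i)) (W i * I a) + W i * ∑ (layer i L) I)
  ≡⟨ sumUpTo-add n _ _ ⟩
    sumUpTo n (λ i → indicator (does (κ a ℕ.≟ i)) (W i * I a)) + sumUpTo n (λ i → W i * ∑ (layer i L) I)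
  ≡⟨ cong₂ _+_ (sumUpTo-delta n (λ i → W i * I a) (κ≤n a)) (sumUpTo-regroup κ n W I κ≤n L) ⟩
    W (κ a) * I a + ∑ L (λ a → W (κ a) * I a)
  ∎
  where
  open ≡-Reasoning
  layer : ℕ → List A → List A
  layer i = filter (λ a → κ a ℕ.≟ i)
  split : ∀ i → W i * ∑ (layer i (a ∷ L)) I
              ≡ indicator (does (κ a ℕ.≟ i)) (W i * I a) + W i * ∑ (layer i L) I
  split i = begin
      W i * ∑ (layer i (a ∷ L)) I
    ≡⟨ cong (W i *_) (∑-filter-cons (λ a → κ a ℕ.≟ i) I a L) ⟩
      W i * (indicator (does (κ a ℕ.≟ i)) (I a) + ∑ (layer i L) I)
    ≡⟨ ℚP.*-distribˡ-+ (W i) _ _ ⟩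
      W i * indicator (does (κ a ℕ.≟ i)) (I a) + W i * ∑ (layer i L) I
    ≡⟨ cong (_+ W i * ∑ (layer i L) I) (*-indicator (W i) _ (I a)) ⟩
      indicator (does (κ a ℕ.≟ i)) (W i * I a) + W i * ∑ (layer i L) I
    ∎

filter-map : ∀ {A B : Set} {P : B → Set} (P? : Decidable P) (g : A → B) L →
  filter P? (map g L) ≡ map g (filter (P? ∘ g) L)
filter-map P? g [] = refl
filter-map P? g (a ∷ L) with does (P? (g a))
... | true = cong (g a ∷_) (filter-map P? g L)
... | false = filter-map P? g L

subsetsOfSize-zero : ∀ n → subsetsOfSize n 0 ≡ ⊥ ∷ []
subsetsOfSize-zero zero = refl
subsetsOfSize-zero (suc n) = begin
    filter isEmpty? (map (outside ∷_) L ++ map (inside ∷_) L)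
  ≡⟨ LP.filter-++ isEmpty? (map (outside ∷_) L) (map (inside ∷_) L) ⟩
    filter isEmpty? (map (outside ∷_) L) ++ filter isEmpty? (map (inside ∷_) L)
  ≡⟨ cong₂ _++_ (trans (filter-map isEmpty? (outside ∷_) L)
                       (cong (map (outside ∷_)) (subsetsOfSize-zero n)))
                (noneEmpty L) ⟩
    (outside ∷ ⊥) ∷ []
  ∎
  where
  open ≡-Reasoning
  L = allSubsets n
  isEmpty? : ∀ {m} (σ : Subset m) → Dec (∣ σ ∣ ≡ 0)
  isEmpty? σ = ∣ σ ∣ ℕ.≟ 0
  noneEmpty : ∀ L → filter isEmpty? (map (inside ∷_) L) ≡ []
  noneEmpty [] = refl
  noneEmpty (σ ∷ L) = noneEmpty L

subsetsOf-⊥ : ∀ n → subsetsOf (⊥ {n}) ≡ ⊥ ∷ []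
subsetsOf-⊥ zero = refl
subsetsOf-⊥ (suc n) = cong (map (outside ∷_)) (subsetsOf-⊥ n)

suc-∸ : ∀ {m n} → m ≤ n → suc n ∸ m ≡ suc (n ∸ m)
suc-∸ m≤n = ℕP.+-∸-assoc 1 m≤n

altSum : ∀ {n} → (Subset n → ℚ) → Subset n → ℚ
altSum G σ = ∑ (subsetsOf σ) (λ γ → sgn ∣ γ ∣ * G γ)

altSum-outside : ∀ {n} (G : Subset (suc n) → ℚ) σ →
  altSum G (outside ∷ σ) ≡ altSum (G ∘ (outside ∷_)) σ
altSum-outside G σ = ∑-map (λ γ → sgn ∣ γ ∣ * G γ) (outside ∷_) (subsetsOf σ)

-- Subsets of σ ∪ {0} either avoid 0 or contain it; the latter carry an extra sign.
altSum-inside : ∀ {n} (G : Subset (suc n) → ℚ) σ →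
  altSum G (inside ∷ σ) ≡ altSum (G ∘ (outside ∷_)) σ + altSum (λ γ → - G (inside ∷ γ)) σ
altSum-inside G σ =
  trans (∑-images (λ γ → sgn ∣ γ ∣ * G γ) (outside ∷_) (inside ∷_) (subsetsOf σ))
        (cong (altSum (G ∘ (outside ∷_)) σ +_) (∑-cong extraSign (subsetsOf σ)))
  where
  extraSign : ∀ γ → sgn (suc ∣ γ ∣) * G (inside ∷ γ) ≡ sgn ∣ γ ∣ * (- G (inside ∷ γ))
  extraSign γ = solve 2 (λ s g → (:- con 1ℚ :* s) :* g := s :* (:- g)) refl
                  (sgn ∣ γ ∣) (G (inside ∷ γ))

module _ (x y : ℚ) where

  signedWeight : ∀ {n} → Subset n → ℚ
  signedWeight {n} σ = sgn ∣ σ ∣ * (x ^ (n ∸ ∣ σ ∣)) * (y ^ ∣ σ ∣)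

  expanded : ∀ n → (Subset n → ℚ) → ℚ
  expanded n G = ∑ (allSubsets n) (λ σ → signedWeight σ * altSum G σ)

  -- Σ_γ G(γ) y^|γ| (x-y)^{n-|γ|}: the double sum with the sum over σ ⊇ γ carried out.
  collected : ∀ n → (Subset n → ℚ) → ℚ
  collected n G = ∑ (allSubsets n) (λ γ → G γ * ((y ^ ∣ γ ∣) * ((x - y) ^ (n ∸ ∣ γ ∣))))

  -- Both sides obey the same recursion in n, splitting on the membership of 0.
  expanded-suc : ∀ n (G : Subset (suc n) → ℚ) →
    expanded (suc n) G
      ≡ x * expanded n (G ∘ (outside ∷_))
        + (- y) * (expanded n (G ∘ (outside ∷_)) + expanded n (λ γ → - G (inside ∷ γ)))
  expanded-suc n G =
    trans (∑-images (λ σ → signedWeight σ * altSum G σ) (outside ∷_) (inside ∷_) L)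
      (cong₂ _+_ (∑-factor x avoiding0 L)
                 (trans (∑-factor (- y) containing0 L) (cong ((- y) *_) (∑-add _ _ L))))
    where
    L = allSubsets n
    G₀ G₁ : Subset n → ℚ
    G₀ = G ∘ (outside ∷_)
    G₁ γ = - G (inside ∷ γ)
    avoiding0 : ∀ σ → signedWeight (outside ∷ σ) * altSum G (outside ∷ σ)
                      ≡ x * (signedWeight σ * altSum G₀ σ)
    avoiding0 σ =
      trans (cong₂ (λ e t → sgn ∣ σ ∣ * (x ^ e) * (y ^ ∣ σ ∣) * t)
                   (suc-∸ (SP.∣p∣≤n σ)) (altSum-outside G σ))
        (solve 5 (λ s x X Y t → s :* (x :* X) :* Y :* t := x :* (s :* X :* Y :* t)) refl
           (sgn ∣ σ ∣) x (x ^ (n ∸ ∣ σ ∣)) (y ^ ∣ σ ∣) (altSum G₀ σ))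
    containing0 : ∀ σ → signedWeight (inside ∷ σ) * altSum G (inside ∷ σ)
                    ≡ (- y) * (signedWeight σ * altSum G₀ σ + signedWeight σ * altSum G₁ σ)
    containing0 σ =
      trans (cong (signedWeight (inside ∷ σ) *_) (altSum-inside G σ))
        (solve 6 (λ s y X Y t u → (:- con 1ℚ :* s) :* X :* (y :* Y) :* (t :+ u)
                     := (:- y) :* (s :* X :* Y :* t :+ s :* X :* Y :* u)) refl
           (sgn ∣ σ ∣) y (x ^ (n ∸ ∣ σ ∣)) (y ^ ∣ σ ∣) (altSum G₀ σ) (altSum G₁ σ))

  collected-suc : ∀ n (G : Subset (suc n) → ℚ) →
    collected (suc n) G
      ≡ (x - y) * collected n (G ∘ (outside ∷_)) + (- y) * collected n (λ γ → - G (inside ∷ γ))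
  collected-suc n G =
    trans (∑-images term (outside ∷_) (inside ∷_) (allSubsets n))
      (cong₂ _+_ (∑-factor (x - y) avoiding0 (allSubsets n))
                 (∑-factor (- y) containing0 (allSubsets n)))
    where
    term : Subset (suc n) → ℚ
    term γ = G γ * ((y ^ ∣ γ ∣) * ((x - y) ^ (suc n ∸ ∣ γ ∣)))
    avoiding0 : ∀ γ → term (outside ∷ γ)
                      ≡ (x - y) * (G (outside ∷ γ) * ((y ^ ∣ γ ∣) * ((x - y) ^ (n ∸ ∣ γ ∣))))
    avoiding0 γ =
      trans (cong (λ e → G (outside ∷ γ) * ((y ^ ∣ γ ∣) * ((x - y) ^ e))) (suc-∸ (SP.∣p∣≤n γ)))
        (solve 4 (λ g Y a A → g :* (Y :* (a :* A)) := a :* (g :* (Y :* A))) refl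
           (G (outside ∷ γ)) (y ^ ∣ γ ∣) (x - y) ((x - y) ^ (n ∸ ∣ γ ∣)))
    containing0 : ∀ γ → term (inside ∷ γ)
                    ≡ (- y) * ((- G (inside ∷ γ)) * ((y ^ ∣ γ ∣) * ((x - y) ^ (n ∸ ∣ γ ∣))))
    containing0 γ = solve 4 (λ g y Y A → g :* ((y :* Y) :* A) := (:- y) :* ((:- g) :* (Y :* A))) refl
                (G (inside ∷ γ)) y (y ^ ∣ γ ∣) ((x - y) ^ (n ∸ ∣ γ ∣))

  exchange : ∀ n (G : Subset n → ℚ) → expanded n G ≡ collected n G
  -- For n = 0 both sides are G(∅).
  exchange zero G =
    solve 1 (λ g → (con 1ℚ :* con 1ℚ :* con 1ℚ) :* (con 1ℚ :* g :+ con 0ℚ) :+ con 0ℚ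
                     := g :* (con 1ℚ :* con 1ℚ) :+ con 0ℚ) refl (G [])
  exchange (suc n) G = begin
      expanded (suc n) G
    ≡⟨ expanded-suc n G ⟩
      x * expanded n G₀ + (- y) * (expanded n G₀ + expanded n G₁)
    ≡⟨ cong₂ (λ A B → x * A + (- y) * (A + B)) (exchange n G₀) (exchange n G₁) ⟩
      x * collected n G₀ + (- y) * (collected n G₀ + collected n G₁)
    ≡⟨ solve 4 (λ x y A B → x :* A :+ (:- y) :* (A :+ B) := (x :- y) :* A :+ (:- y) :* B)
         refl x y (collected n G₀) (collected n G₁) ⟩
      (x - y) * collected n G₀ + (- y) * collected n G₁
    ≡⟨ sym (collected-suc n G) ⟩
      collected (suc n) G
    ∎
    where
    open ≡-Reasoning
    G₀ G₁ : Subset n → ℚ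
    G₀ = G ∘ (outside ∷_)
    G₁ γ = - G (inside ∷ γ)

nullity-⊥ : ∀ {n} (M : Matroid n) → nullity M ⊥ ≡ 0
nullity-⊥ {n} M = trans (cong (_∸ rank M ⊥) (SP.∣⊥∣≡0 n)) (ℕP.0∸n≡0 (rank M ⊥))

altSum-⊥ : ∀ n (G : Subset n → ℚ) → altSum G ⊥ ≡ G ⊥
altSum-⊥ n G = begin
    ∑ (subsetsOf ⊥) (λ γ → sgn ∣ γ ∣ * G γ)   ≡⟨ cong (λ L → ∑ L (λ γ → sgn ∣ γ ∣ * G γ)) (subsetsOf-⊥ n) ⟩
    sgn ∣ ⊥ {n} ∣ * G ⊥ + 0ℚ                   ≡⟨ cong (λ m → sgn m * G ⊥ + 0ℚ) (SP.∣⊥∣≡0 n) ⟩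
    1ℚ * G ⊥ + 0ℚ                              ≡⟨ solve 1 (λ g → con 1ℚ :* g :+ con 0ℚ := g) refl (G ⊥) ⟩
    G ⊥                                        ∎
  where open ≡-Reasoning

-- P_{M,i}(z) = (-1)^i Σ_{|σ|=i} Σ_{γ⊆σ} (-1)^|γ| z^{n_M(γ)} also for i = 0,
-- since the right-hand side then reduces to z^{n_M(∅)} = 1.
weightPoly-layer : ∀ {n} (M : Matroid n) (z : ℚ) i →
  weightPoly M i z ≡ sgn i * ∑ (subsetsOfSize n i) (altSum (λ γ → z ^ nullity M γ))
weightPoly-layer {n} M z zero = sym (begin
    1ℚ * ∑ (subsetsOfSize n 0) (altSum G)   ≡⟨ ℚP.*-identityˡ _ ⟩
    ∑ (subsetsOfSize n 0) (altSum G)        ≡⟨ cong (λ L → ∑ L (altSum G)) (subsetsOfSize-zero n) ⟩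
    altSum G ⊥ + 0ℚ                         ≡⟨ ℚP.+-identityʳ _ ⟩
    altSum G ⊥                              ≡⟨ altSum-⊥ n G ⟩
    z ^ nullity M ⊥                         ≡⟨ cong (z ^_) (nullity-⊥ M) ⟩
    1ℚ                                      ∎)
  where
  open ≡-Reasoning
  G : Subset n → ℚ
  G γ = z ^ nullity M γ
weightPoly-layer M z (suc j) = refl

enumerator-expanded : ∀ {n} (M : Matroid n) (x y z : ℚ) →
  enumerator M x y z ≡ expanded x y n (λ γ → z ^ nullity M γ)
enumerator-expanded {n} M x y z =
  trans (sumUpTo-cong n perLayer) (sumUpTo-regroup ∣_∣ n W (altSum G) SP.∣p∣≤n (allSubsets n))
  where
  G : Subset n → ℚ
  G γ = z ^ nullity M γ
  W : ℕ → ℚ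
  W i = sgn i * (x ^ (n ∸ i)) * (y ^ i)
  perLayer : ∀ i → weightPoly M i z * (x ^ (n ∸ i)) * (y ^ i)
                     ≡ W i * ∑ (subsetsOfSize n i) (altSum G)
  perLayer i =
    trans (cong (λ p → p * (x ^ (n ∸ i)) * (y ^ i)) (weightPoly-layer M z i))
      (solve 4 (λ s S X Y → s :* S :* X :* Y := s :* X :* Y :* S) refl
         (sgn i) (∑ (subsetsOfSize n i) (altSum G)) (x ^ (n ∸ i)) (y ^ i))

÷-minus-one : ∀ (p q : ℚ) .{{_ : NonZero q}} → p ÷ q - 1ℚ ≡ (p - q) * 1/ q
÷-minus-one p q =
  trans (cong (λ t → p * 1/ q - t) (sym (ℚP.*-inverseʳ q)))
        (solve 3 (λ p q i → p :* i :- q :* i := (p :- q) :* i) refl p q (1/ q))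

rescaled-monomial : ∀ (a y z ia iy : ℚ) → y * iy ≡ 1ℚ → a * ia ≡ 1ℚ →
  ∀ {r k m n} → r ≤ k → k ≤ n → r ≤ m → m ≤ n →
  (a ^ (n ∸ k) * y ^ k) * ((a * iy) ^ (k ∸ r) * (z * y * ia) ^ (m ∸ r))
    ≡ z ^ (m ∸ r) * (y ^ m * a ^ (n ∸ m))
rescaled-monomial a y z ia iy y*iy≡1 a*ia≡1 {r} {k} {m} {n} r≤k k≤n r≤m m≤n = begin
    (a ^ (n ∸ k) * y ^ k) * (U * V)
  ≡⟨ cong (λ t → (a ^ (n ∸ k) * t) * (U * V)) (sym (pow-telescope y z≤n r≤k)) ⟩
    (a ^ (n ∸ k) * (y ^ r * y ^ (k ∸ r))) * (U * V)
  ≡⟨ solve 6 (λ A Yr Ykr U V X → (A :* (Yr :* Ykr)) :* (U :* V) := (U :* Ykr) :* A :* (V :* Yr))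
       refl (a ^ (n ∸ k)) (y ^ r) (y ^ (k ∸ r)) U V 0ℚ ⟩
    (U * y ^ (k ∸ r)) * a ^ (n ∸ k) * (V * y ^ r)
  ≡⟨ cong (λ t → t * a ^ (n ∸ k) * (V * y ^ r)) (pow-÷-cancel a y iy y*iy≡1 (k ∸ r)) ⟩
    a ^ (k ∸ r) * a ^ (n ∸ k) * (V * y ^ r)
  ≡⟨ cong (_* (V * y ^ r)) (trans (pow-telescope a r≤k k≤n) (sym (pow-telescope a r≤m m≤n))) ⟩
    a ^ (m ∸ r) * a ^ (n ∸ m) * (V * y ^ r)
  ≡⟨ solve 5 (λ Amr Anm V Yr X → Amr :* Anm :* (V :* Yr) := (V :* Amr) :* (Yr :* Anm))
       refl (a ^ (m ∸ r)) (a ^ (n ∸ m)) V (y ^ r) 0ℚ ⟩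
    (V * a ^ (m ∸ r)) * (y ^ r * a ^ (n ∸ m))
  ≡⟨ cong (_* (y ^ r * a ^ (n ∸ m)))
       (trans (pow-÷-cancel (z * y) a ia a*ia≡1 (m ∸ r)) (pow-* z y (m ∸ r))) ⟩
    (z ^ (m ∸ r) * y ^ (m ∸ r)) * (y ^ r * a ^ (n ∸ m))
  ≡⟨ solve 5 (λ Z Ymr Yr A X → (Z :* Ymr) :* (Yr :* A) := Z :* ((Yr :* Ymr) :* A))
       refl (z ^ (m ∸ r)) (y ^ (m ∸ r)) (y ^ r) (a ^ (n ∸ m)) 0ℚ ⟩
    z ^ (m ∸ r) * ((y ^ r * y ^ (m ∸ r)) * a ^ (n ∸ m))
  ≡⟨ cong (λ t → z ^ (m ∸ r) * (t * a ^ (n ∸ m))) (pow-telescope y z≤n r≤m) ⟩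
    z ^ (m ∸ r) * (y ^ m * a ^ (n ∸ m))
  ∎
  where
  open ≡-Reasoning
  U = (a * iy) ^ (k ∸ r)
  V = (z * y * ia) ^ (m ∸ r)

tutte-summand : ∀ {n} (M : Matroid n) (x y z : ℚ) .{{_ : NonZero y}} .{{_ : NonZero (x - y)}} →
  ∀ σ → ((x - y) ^ (n ∸ matroidRank M)) * (y ^ matroidRank M)
          * (((x ÷ y - 1ℚ) ^ (matroidRank M ∸ rank M σ))
             * ((((x + (z - 1ℚ) * y) ÷ (x - y)) - 1ℚ) ^ nullity M σ))
        ≡ z ^ nullity M σ * ((y ^ ∣ σ ∣) * ((x - y) ^ (n ∸ ∣ σ ∣)))
tutte-summand {n} M x y z σ =
  trans (cong₂ (λ u v → ((x - y) ^ (n ∸ k)) * (y ^ k) * ((u ^ (k ∸ r)) * (v ^ (m ∸ r))))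
               (÷-minus-one x y)
               (trans (÷-minus-one (x + (z - 1ℚ) * y) (x - y)) (cong (_* 1/ (x - y)) shift)))
        (rescaled-monomial (x - y) y z (1/ (x - y)) (1/ y)
           (ℚP.*-inverseʳ y) (ℚP.*-inverseʳ (x - y)) r≤k k≤n r≤m (SP.∣p∣≤n σ))
  where
  k = matroidRank M
  r = rank M σ
  m = ∣ σ ∣
  shift : x + (z - 1ℚ) * y - (x - y) ≡ z * y
  shift = solve 3 (λ x y z → x :+ (z :- con 1ℚ) :* y :- (x :- y) := z :* y) refl x y z
  r≤k : r ≤ k
  r≤k = rank-mono M σ ⊤ SP.⊆⊤
  k≤n : k ≤ n
  k≤n = subst (k ≤_) (SP.∣⊤∣≡n n) (rank-≤ M ⊤)
  r≤m : r ≤ m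
  r≤m = rank-≤ M σ

theorem3 : (n k : ℕ) (M : Matroid n) → matroidRank M ≡ k →
    (x y z : ℚ) .{{_ : NonZero y}} .{{_ : NonZero (x - y)}} →
    enumerator M x y z
      ≡ ((x - y) ^ (n ∸ k)) * (y ^ k)
          * tutte M (x ÷ y) ((x + (z - 1ℚ) * y) ÷ (x - y))
theorem3 n .(matroidRank M) M refl x y z = begin
    enumerator M x y z
  ≡⟨ enumerator-expanded M x y z ⟩
    expanded x y n G
  ≡⟨ exchange x y n G ⟩
    collected x y n G
  ≡⟨ ∑-factor (((x - y) ^ (n ∸ matroidRank M)) * (y ^ matroidRank M))
       (λ σ → sym (tutte-summand M x y z σ)) (allSubsets n) ⟩
    ((x - y) ^ (n ∸ matroidRank M)) * (y ^ matroidRank M)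
      * tutte M (x ÷ y) ((x + (z - 1ℚ) * y) ÷ (x - y))
  ∎
  where
  open ≡-Reasoning
  G : Subset n → ℚ
  G γ = z ^ nullity M γ
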